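{- For any string $S$, $|\mathcal{PS}_S| \leq |S| + |\mathcal{M}_S| - 1$.
   Context: For a string $S$ of length $n$ and $1 \le i \le j \le n$, $S[i..j]$ is the substring from position $i$ to position $j$, and $\#\mathit{occ}_S(w)$ is the number of positions $i$ with $S[i..i+|w|-1]=w$. A non-empty substring $w$ is unique if $\#\mathit{occ}_S(w)=1$ and repeating if $\#\mathit{occ}_S(w)\ge 2$; an interval $[i,j]$ is called unique/repeating according to $S[i..j]$. An interval $[i,j]$ is a minimal unique substring (MUS) of $S$ if $S[i..j]$ is unique and every proper substring $S[i'..j']$ with $i\le i'$, $j'\le j$, $j'-i'<j-i$ is repeating; $\mathcal{M}_S$ is the set of all MUS intervals of $S$. For intervals, $[s,t]\subset[i,j]$ means $i\le s$ and $t\le j$. For an interval $[s,t]$, an interval $[i,j]$ is a shortest unique substring (SUS) for $[s,t]$ if (1) $S[i..j]$ is unique, (2) $[s,t]\subset[i,j]$, and (3) $S[i'..j']$ is repeating for every $[i',j']$ with $[s,t]\subset[i',j']$ and $j'-i'<j-i$. $\mathsf{SUS}_S(p)$ denotes the set of SUSs for $[p,p]$, and $\mathcal{PS}_S=\bigcup_{p=1}^{n}\mathsf{SUS}_S(p)$ is the set of all point SUSs of $S$. -}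

module Defs where

open import Level using (Level)
open import Data.Nat using (ℕ; _+_; _∸_; _≤_; _<_)
open import Data.Fin using (fromℕ<)
open import Data.Vec using (Vec; lookup)
open import Data.Product using (_×_; ∃; _,_)
open import Data.List using (List)
open import Data.List.Membership.Propositional using (_∈_)
open import Data.List.Relation.Unary.Unique.Propositional using (Unique)
open import Relation.Binary.PropositionalEquality using (_≡_; _≢_)
open import Function.Bundles using (_⇔_)

-- Conventions: a string of length n is a vector S : Vec A n, positions are
-- 0-based (paper position p ↦ p - 1).  An interval [i,j] is a pair (i , j);
-- it is a valid interval of S iff i ≤ j < n.

Interval : Set
Interval = ℕ × ℕ

module _ {a : Level} {A : Set a} {n : ℕ} (S : Vec A n) where

  Valid : ℕ → ℕ → Set
  Valid i j = i ≤ j × j < n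

  OccursAt : ℕ → ℕ → ℕ → Set a
  OccursAt i j k =
    k + (j ∸ i) < n ×
    (∀ m → m ≤ j ∸ i → (p : k + m < n) (q : i + m < n) →
       lookup S (fromℕ< p) ≡ lookup S (fromℕ< q))

  -- #occ_S(S[i..j]) = 1  (the occurrence at i itself always exists)
  IsUnique : ℕ → ℕ → Set a
  IsUnique i j = Valid i j × (∀ k → OccursAt i j k → k ≡ i)

  -- #occ_S(S[i..j]) ≥ 2 : there is an occurrence besides the one at i
  IsRepeating : ℕ → ℕ → Set a
  IsRepeating i j = Valid i j × ∃ λ k → k ≢ i × OccursAt i j k

  MUS : Interval → Set a
  MUS (i , j) =
    IsUnique i j ×
    (∀ i' j' → i ≤ i' → j' ≤ j → i' ≤ j' → j' ∸ i' < j ∸ i → IsRepeating i' j')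

  SUS : ℕ → ℕ → Interval → Set a
  SUS s t (i , j) =
    IsUnique i j × i ≤ s × t ≤ j ×
    (∀ i' j' → i' ≤ s → t ≤ j' → j' < n → j' ∸ i' < j ∸ i → IsRepeating i' j')

  PointSUS : Interval → Set a
  PointSUS I = ∃ λ p → p < n × SUS p p I

-- L is a duplicate-free list whose elements are exactly the intervals
-- satisfying P; then |{I | P I}| = length L.
Enumerates : {a : Level} → (Interval → Set a) → List Interval → Set a
Enumerates P L = Unique L × (∀ I → (I ∈ L) ⇔ P I)

module Submission where

-- Every point SUS I = [i,j] (a SUS for some position p) that is a MUS is
-- labelled by its index in the enumeration of M_S.  A point SUS that is not a
-- MUS must be "anchored": if i < p < j, shrinking I on either side keeps p
-- inside, so both one-shorter subintervals are repeating and I would be a MUS;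
-- if i = p = j, then I is a unique single letter, again a MUS.  So either
-- p = i < j (left-anchored, label i) or i < j = p (right-anchored, label j-1),
-- giving a label below n - 1, shifted past the MUS labels.  Labels are
-- injective: two SUSs for the same point have equal length, so a left-anchored
-- (right-anchored) SUS is determined by its start (end); and a left-anchored
-- SUS [k,t] together with a right-anchored SUS [s,k+1] forces [s,k+1] to be a
-- MUS.  A pigeonhole counting principle then yields the bound.

open import Defs
open import Level using (Level)
open import Data.Nat using (ℕ; _+_; _∸_; _≤_)
open import Data.Vec using (Vec)
open import Data.List using (List; length)

open import Data.Nat using (zero; suc; _<_; z≤n; s≤s; _<?_; _≟_)
open import Data.Nat.Properties
open import Data.Fin using (Fin; fromℕ<; toℕ) renaming (_<_ to _<ᶠ_)
open import Data.Fin.Properties using (pigeonhole; toℕ-fromℕ<; toℕ<n; fromℕ<-toℕ; fromℕ<-cong)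
open import Data.Vec using (lookup)
import Data.List as List
open import Data.List using ([]; _∷_)
open import Data.List.Membership.Propositional using (_∈_)
open import Data.List.Membership.Propositional.Properties using (∈-lookup)
open import Data.Product.Properties using (≡-dec)
open import Data.List.Membership.DecPropositional (≡-dec _≟_ _≟_) using (_∈?_)
open import Data.List.Relation.Unary.Unique.Propositional using (Unique)
open import Data.List.Relation.Unary.AllPairs using (_∷_)
import Data.List.Relation.Unary.All as All
open import Data.List.Relation.Unary.Any using (here; index)
open import Data.List.Relation.Unary.Any.Properties using (lookup-index)
open import Data.Product using (Σ; ∃; _×_; _,_; proj₁; proj₂)
open import Data.Sum using (_⊎_; inj₁; inj₂)
open import Data.Empty using (⊥-elim)
open import Relation.Nullary using (¬_; yes; no)
open import Relation.Binary.PropositionalEquality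
open import Function.Bundles using (Equivalence)
open import Function.Base using (_∘_)

-- Strict upper bounds in ℕ, stated with n ∸ 1 (not definitionally pred n).
<⇒≤∸1 : ∀ {m n} → m < n → m ≤ n ∸ 1
<⇒≤∸1 (s≤s m≤n) = m≤n

unique-lookup : ∀ {X : Set} {xs : List X} → Unique xs →
  ∀ {i j : Fin (length xs)} → i <ᶠ j → List.lookup xs i ≢ List.lookup xs j
unique-lookup {xs = _ ∷ xs} (x∉xs ∷ _) {Fin.zero} {Fin.suc j} _ =
  All.lookup x∉xs (∈-lookup {xs = xs} j)
unique-lookup {xs = _ ∷ _} (_ ∷ u) {Fin.suc _} {Fin.suc _} (s≤s i<j) =
  unique-lookup u i<j

unique-labelled-length≤ : ∀ {r} {X : Set} (xs : List X) → Unique xs →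
  (m : ℕ) (Label : X → ℕ → Set r) →
  (∀ {x} → x ∈ xs → ∃ λ k → k < m × Label x k) →
  (∀ {x y k} → Label x k → Label y k → x ≡ y) →
  length xs ≤ m
unique-labelled-length≤ xs u m Label labelOf injective = ≮⇒≥ noCollision
  where
  elem : Fin (length xs) → _
  elem i = List.lookup xs i
  labelAt : (i : Fin (length xs)) → ∃ λ k → k < m × Label (elem i) k
  labelAt i = labelOf (∈-lookup {xs = xs} i)
  f : Fin (length xs) → Fin m
  f i = fromℕ< (proj₁ (proj₂ (labelAt i)))
  noCollision : ¬ (m < length xs)
  noCollision m<len with pigeonhole m<len f
  ... | i , j , i<j , fi≡fj = unique-lookup u i<j (injective Lᵢ Lⱼ)
    where
    sameLabel : proj₁ (labelAt j) ≡ proj₁ (labelAt i)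
    sameLabel = trans (sym (toℕ-fromℕ< _)) (trans (cong toℕ (sym fi≡fj)) (toℕ-fromℕ< _))
    Lᵢ : Label (elem i) (proj₁ (labelAt i))
    Lᵢ = proj₂ (proj₂ (labelAt i))
    Lⱼ : Label (elem j) (proj₁ (labelAt i))
    Lⱼ = subst (Label (elem j)) sameLabel (proj₂ (proj₂ (labelAt j)))

module _ {a : Level} {A : Set a} {n : ℕ} (S : Vec A n) where

  unique⇒¬repeating : ∀ {i j} → IsUnique S i j → ¬ IsRepeating S i j
  unique⇒¬repeating (_ , only-i) (_ , k , k≢i , occ) = k≢i (only-i k occ)

  occursAt-inner : ∀ {i j i' j' k} → i ≤ j → i ≤ i' → j' ≤ j → i' ≤ j' →
    OccursAt S i j k → OccursAt S i' j' (k + (i' ∸ i))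
  occursAt-inner {i} {j} {i'} {j'} {k} i≤j i≤i' j'≤j i'≤j' (fits , agree) =
    fits' , agree'
    where
    d = i' ∸ i
    i+d≡i' : i + d ≡ i'
    i+d≡i' = m+[n∸m]≡n i≤i'
    inner : d + (j' ∸ i') ≤ j ∸ i
    inner = +-cancelˡ-≤ i _ _ (begin
      i + (d + (j' ∸ i')) ≡⟨ sym (+-assoc i d _) ⟩
      i + d + (j' ∸ i')   ≡⟨ cong (_+ (j' ∸ i')) i+d≡i' ⟩
      i' + (j' ∸ i')      ≡⟨ m+[n∸m]≡n i'≤j' ⟩
      j'                  ≤⟨ j'≤j ⟩
      j                   ≡⟨ sym (m+[n∸m]≡n i≤j) ⟩
      i + (j ∸ i)         ∎)
      where open ≤-Reasoning
    fits' : k + d + (j' ∸ i') < n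
    fits' = ≤-<-trans (≤-trans (≤-reflexive (+-assoc k d _)) (+-monoʳ-≤ k inner)) fits
    agree' : ∀ m → m ≤ j' ∸ i' → (p : k + d + m < n) (q : i' + m < n) →
      lookup S (fromℕ< p) ≡ lookup S (fromℕ< q)
    agree' m m≤ p q = begin
      lookup S (fromℕ< p)  ≡⟨ cong (lookup S) (fromℕ<-cong _ _ (+-assoc k d m) p p') ⟩
      lookup S (fromℕ< p') ≡⟨ agree (d + m) (≤-trans (+-monoʳ-≤ d m≤) inner) p' q' ⟩
      lookup S (fromℕ< q') ≡⟨ cong (lookup S) (fromℕ<-cong _ _ shift q' q) ⟩
      lookup S (fromℕ< q)  ∎
      where
      open ≡-Reasoning
      shift : i + (d + m) ≡ i' + m
      shift = trans (sym (+-assoc i d m)) (cong (_+ m) i+d≡i')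
      p' : k + (d + m) < n
      p' = subst (_< n) (+-assoc k d m) p
      q' : i + (d + m) < n
      q' = subst (_< n) (sym shift) q

  repeating-inner : ∀ {i j i' j'} → i ≤ i' → j' ≤ j → i' ≤ j' →
    IsRepeating S i j → IsRepeating S i' j'
  repeating-inner {i} {i' = i'} i≤i' j'≤j i'≤j' ((i≤j , j<n) , k , k≢i , occ) =
    (i'≤j' , ≤-<-trans j'≤j j<n) , k + (i' ∸ i) , shifted≢i' ,
    occursAt-inner i≤j i≤i' j'≤j i'≤j' occ
    where
    shifted≢i' : k + (i' ∸ i) ≢ i'
    shifted≢i' e = k≢i (+-cancelʳ-≡ (i' ∸ i) k i (trans e (sym (m+[n∸m]≡n i≤i'))))

  -- A unique interval whose two one-shorter subintervals are repeating is a
  -- MUS: every shorter subinterval lies inside one of them.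
  mus-intro : ∀ {i j} → IsUnique S i j →
    (i < j → IsRepeating S (suc i) j) → (i < j → IsRepeating S i (j ∸ 1)) →
    MUS S (i , j)
  mus-intro {i} {j} u dropFirst dropLast = u , shorter
    where
    shorter : ∀ i' j' → i ≤ i' → j' ≤ j → i' ≤ j' → j' ∸ i' < j ∸ i →
      IsRepeating S i' j'
    shorter i' j' i≤i' j'≤j i'≤j' shorter-len with i <? i'
    ... | yes i<i' = repeating-inner i<i' j'≤j i'≤j'
                       (dropFirst (<-≤-trans i<i' (≤-trans i'≤j' j'≤j)))
    ... | no i≮i' = repeating-inner i≤i' (<⇒≤∸1 j'<j) i'≤j'
                      (dropLast (≤-<-trans (≤-trans i≤i' i'≤j') j'<j))
      where
      i'≡i : i' ≡ i
      i'≡i = ≤-antisym (≮⇒≥ i≮i') i≤i'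
      j'<j : j' < j
      j'<j = ≰⇒> λ j≤j' → <⇒≱ shorter-len
        (subst (λ z → j ∸ i ≤ j' ∸ z) (sym i'≡i) (∸-monoˡ-≤ i j≤j'))

  sus-same-length : ∀ {p i j i' j'} → SUS S p p (i , j) → SUS S p p (i' , j') →
    j ∸ i ≡ j' ∸ i'
  sus-same-length s s' = ≤-antisym (≮⇒≥ (not-shorter s s')) (≮⇒≥ (not-shorter s' s))
    where
    not-shorter : ∀ {p i j i' j'} → SUS S p p (i , j) → SUS S p p (i' , j') →
      ¬ (j' ∸ i' < j ∸ i)
    not-shorter (_ , _ , _ , minimal) (u' , i'≤p , p≤j' , _) shorter =
      unique⇒¬repeating u' (minimal _ _ i'≤p p≤j' (proj₂ (proj₁ u')) shorter)

  -- Dropping the first letter of a SUS for p is repeating if p is not that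
  -- letter, since the rest still contains p and is shorter.
  sus-dropFirst : ∀ {p i j} → SUS S p p (i , j) → i < p → IsRepeating S (suc i) j
  sus-dropFirst {p} {i} {j} (u , _ , p≤j , minimal) i<p =
    minimal (suc i) j i<p p≤j (proj₂ (proj₁ u))
      (∸-monoʳ-< {j} {suc i} {i} ≤-refl (<-≤-trans i<p p≤j))

  sus-dropLast : ∀ {p i j} → SUS S p p (i , j) → p < j → IsRepeating S i (j ∸ 1)
  sus-dropLast {p} {i} {j} (u , i≤p , _ , minimal) p<j =
    minimal i (j ∸ 1) i≤p (<⇒≤∸1 p<j) (≤-<-trans (m∸n≤m j 1) (proj₂ (proj₁ u)))
      (subst (_< j ∸ i) (sym (∸-+-assoc j 1 i))
        (∸-monoʳ-< {j} {suc i} {i} ≤-refl (≤-<-trans i≤p p<j)))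

  -- A point SUS which is not a MUS is anchored at one of its ends; it is
  -- labelled by its start when it is a SUS for its first position, and by
  -- its end minus one when it is a SUS for its last position.
  data AnchorLabel : Interval → ℕ → Set a where
    left  : ∀ {k j} → k < j → SUS S k k (k , j) → AnchorLabel (k , j) k
    right : ∀ {i k} → i ≤ k → SUS S (suc k) (suc k) (i , suc k) →
            AnchorLabel (i , suc k) k

  -- Classification: a point SUS that is a SUS for an interior position, or a
  -- single letter, is a MUS; so a non-MUS point SUS has an anchor label.
  anchorLabel : ∀ {I} → PointSUS S I → ¬ MUS S I → ∃ λ k → k < n ∸ 1 × AnchorLabel I k
  anchorLabel {i , j} (p , _ , sus@(u , i≤p , p≤j , _)) notMUS
    with p ≟ i | p ≟ j | i <? j
  ... | yes refl | _ | yes i<j = i , <-≤-trans i<j (<⇒≤∸1 (proj₂ (proj₁ u))) , left i<j sus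
  ... | yes refl | _ | no i≮j  =
        ⊥-elim (notMUS (mus-intro u (⊥-elim ∘ i≮j) (⊥-elim ∘ i≮j)))
  ... | no p≢i | yes refl | _ = rightLabel (≤∧≢⇒< i≤p (p≢i ∘ sym)) sus
    where
    rightLabel : ∀ {i j} → i < j → SUS S j j (i , j) →
      ∃ λ k → k < n ∸ 1 × AnchorLabel (i , j) k
    rightLabel {j = suc k} (s≤s i≤k) sus@(u , _) =
      k , <⇒≤∸1 (proj₂ (proj₁ u)) , right i≤k sus
  ... | no p≢i | no p≢j | _ = ⊥-elim (notMUS (mus-intro u
        (λ _ → sus-dropFirst sus (≤∧≢⇒< i≤p (p≢i ∘ sym)))
        (λ _ → sus-dropLast sus (≤∧≢⇒< p≤j p≢j))))

  -- A left-anchored SUS [k,t] for k and a right-anchored SUS [s,k+1] for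
  -- k+1 force [s,k+1] to be a MUS: [s,k] is shorter than [s,k+1] and
  -- contains k, so it is repeating since [k,t] is not longer than [s,k+1].
  adjacent-anchors⇒MUS : ∀ {k t s} → SUS S k k (k , t) → k < t →
    SUS S (suc k) (suc k) (s , suc k) → s ≤ k → MUS S (s , suc k)
  adjacent-anchors⇒MUS {k} {t} {s} (uL , _ , _ , minimalL) k<t
                                   susR@(uR , _ , _ , minimalR) s≤k =
    mus-intro uR (λ _ → sus-dropFirst susR (s≤s s≤k)) (λ _ → dropLast)
    where
    t<n : t < n
    t<n = proj₂ (proj₁ uL)
    right-not-shorter : ¬ (t ∸ k < suc k ∸ s)
    right-not-shorter shorter =
      unique⇒¬repeating uL (minimalR k t (n≤1+n k) k<t t<n shorter)
    dropLast : IsRepeating S s k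
    dropLast = minimalL s k s≤k ≤-refl (<-trans k<t t<n)
      (<-≤-trans (subst (k ∸ s <_) (sym (+-∸-assoc 1 s≤k)) ≤-refl)
                 (≮⇒≥ right-not-shorter))

  anchorLabel-injective : ∀ {I J k} → ¬ MUS S I → ¬ MUS S J →
    AnchorLabel I k → AnchorLabel J k → I ≡ J
  anchorLabel-injective _ _ (left k<j s) (left k<j' s') =
    cong (_ ,_) (∸-cancelʳ-≡ (<⇒≤ k<j) (<⇒≤ k<j') (sus-same-length s s'))
  anchorLabel-injective _ _ (right i≤k s) (right i'≤k s') =
    cong (_, _) (∸-cancelˡ-≡ (m≤n⇒m≤1+n i≤k) (m≤n⇒m≤1+n i'≤k) (sus-same-length s s'))
  anchorLabel-injective _ notMUS (left k<t s) (right s≤k s') =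
    ⊥-elim (notMUS (adjacent-anchors⇒MUS s k<t s' s≤k))
  anchorLabel-injective notMUS _ (right s≤k s') (left k<t s) =
    ⊥-elim (notMUS (adjacent-anchors⇒MUS s k<t s' s≤k))

  Label : List Interval → Interval → ℕ → Set a
  Label Ms I k = (Σ (k < length Ms) λ k<len → List.lookup Ms (fromℕ< k<len) ≡ I)
               ⊎ (¬ MUS S I × ∃ λ k' → k ≡ length Ms + k' × AnchorLabel I k')

  label-injective : ∀ {Ms I J k} → Label Ms I k → Label Ms J k → I ≡ J
  label-injective (inj₁ (_ , eI)) (inj₁ (_ , eJ)) = trans (sym eI) eJ
  label-injective {Ms} (inj₁ (k<len , _)) (inj₂ (_ , k' , refl , _)) =
    ⊥-elim (m+n≮m (length Ms) k' k<len)
  label-injective {Ms} (inj₂ (_ , k' , refl , _)) (inj₁ (k<len , _)) =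
    ⊥-elim (m+n≮m (length Ms) k' k<len)
  label-injective {Ms} (inj₂ (¬I , k₁ , refl , aI)) (inj₂ (¬J , k₂ , e , aJ)) =
    anchorLabel-injective ¬I ¬J aI
      (subst (AnchorLabel _) (+-cancelˡ-≡ (length Ms) k₂ k₁ (sym e)) aJ)

  pointSUS-label : ∀ {Ms I} → Enumerates (MUS S) Ms → PointSUS S I →
    ∃ λ k → k < length Ms + (n ∸ 1) × Label Ms I k
  pointSUS-label {Ms} {I} (_ , enumM) ps with I ∈? Ms
  ... | yes I∈Ms = toℕ (index I∈Ms) , ≤-trans (toℕ<n _) (m≤m+n _ _) ,
        inj₁ (toℕ<n _ , trans (cong (List.lookup Ms) (fromℕ<-toℕ _ _)) (sym (lookup-index I∈Ms)))
  ... | no I∉Ms with anchorLabel ps (I∉Ms ∘ Equivalence.from (enumM I))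
  ...   | k , k<n∸1 , anchored =
          length Ms + k , +-monoʳ-< (length Ms) k<n∸1 ,
          inj₂ (I∉Ms ∘ Equivalence.from (enumM I) , k , refl , anchored)

theorem2 : {a : Level} {A : Set a} (n : ℕ) (S : Vec A n)
    (PS Ms : List Interval) →
    Enumerates (PointSUS S) PS → Enumerates (MUS S) Ms →
    length PS ≤ n + length Ms ∸ 1
theorem2 zero S [] Ms _ _ = z≤n
theorem2 zero S (I ∷ PS) Ms (_ , enumPS) _ with Equivalence.to (enumPS I) (here refl)
... | _ , () , _
theorem2 (suc n) S PS Ms (uniquePS , enumPS) enumM = begin
  length PS      ≤⟨ unique-labelled-length≤ PS uniquePS _ (Label S Ms)
                      (pointSUS-label S enumM ∘ Equivalence.to (enumPS _)) (label-injective S {Ms}) ⟩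
  length Ms + n  ≡⟨ +-comm (length Ms) n ⟩
  suc n + length Ms ∸ 1 ∎
  where open ≤-Reasoning
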